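{- Let $H$ be a bigraph. If $S$ is a strong component of $H^+$, then $S'=\{(v,u):(u,v)\in S\}$ is also a strong component of $H^+$.
   Context: A bigraph is a bipartite graph $H$ with a fixed bipartition $V(H)=B\cup W$; two vertices have the same colour if they lie in the same part. The pair-digraph $H^+$ has as vertices all ordered pairs $(u,v)$ of distinct vertices of $H$, and arcs: $(u,v)\to(u',v)$ whenever $u,v$ have the same colour, $uu'\in E(H)$ and $vu'\notin E(H)$; and $(u,v)\to(u,v')$ whenever $u,v$ have different colours, $vv'\in E(H)$ and $uv\notin E(H)$. -}

module Defs where

open import Data.Nat using (ℕ)
open import Data.Fin using (Fin)
open import Data.Bool using (Bool)
open import Data.Product using (_×_; _,_; ∃; Σ)
open import Relation.Binary.PropositionalEquality using (_≡_; _≢_)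
open import Relation.Nullary using (¬_)
open import Relation.Binary.Construct.Closure.ReflexiveTransitive using (Star)
open import Level using (0ℓ)

-- A (finite, simple) bigraph: bipartite graph with a fixed bipartition,
-- given by a colour function; vertices are Fin n.
record Bigraph : Set₁ where
  field
    n       : ℕ
    colour  : Fin n → Bool
    E       : Fin n → Fin n → Set
    E-sym   : ∀ {u v} → E u v → E v u
    E-bip   : ∀ {u v} → E u v → colour u ≢ colour v

module PairDigraph (H : Bigraph) where
  open Bigraph H

  V : Set
  V = Fin n

  IsPairVertex : V × V → Set
  IsPairVertex (u , v) = u ≢ v

  data Arc : V × V → V × V → Set where
    arc-same : ∀ {u v u'} → u ≢ v → u' ≢ v →
               colour u ≡ colour v → E u u' → ¬ E v u' →
               Arc (u , v) (u' , v)
    arc-diff : ∀ {u v v'} → u ≢ v → u ≢ v' →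
               colour u ≢ colour v → E v v' → ¬ E u v →
               Arc (u , v) (u , v')

  Reach : V × V → V × V → Set
  Reach = Star Arc

  _⇄_ : V × V → V × V → Set
  x ⇄ y = Reach x y × Reach y x

  record StrongComponent (S : V × V → Set) : Set where
    field
      vertices  : ∀ x → S x → IsPairVertex x
      nonempty  : ∃ S
      connected : ∀ x y → S x → S y → x ⇄ y
      maximal   : ∀ x y → S x → IsPairVertex y → x ⇄ y → S y

  reverse : (V × V → Set) → (V × V → Set)
  reverse S (v , u) = S (u , v)

module Submission where

-- The pair-digraph H⁺ is skew-symmetric with respect to swapping the two
-- coordinates of a pair: every arc x → y of H⁺ yields an arc
-- swap y → swap x.  Indeed, an arc (u,v) → (u',v) between same-coloured
-- u,v is turned into the arc (v,u') → (v,u) between differently-coloured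
-- v,u' (the edge u u' is used backwards), and conversely an arc
-- (u,v) → (u,v') between differently-coloured u,v becomes the arc
-- (v',u) → (v,u) between the same-coloured v',u; the only colour fact
-- needed is that two colours both different from a third are equal.
--
-- Reversing paths lifts this to reachability, so swap maps mutually
-- reachable pairs to mutually reachable pairs.  Since swap is an
-- involution, it carries a strong component S to the set S' of swapped
-- pairs, and each axiom of a strong component for S' is the
-- corresponding axiom for S read through swap.

open import Defs
open import Data.Bool using (Bool)
open import Data.Bool.Properties using (¬-not)
open import Data.Product using (_×_; _,_; swap)
open import Function using (_∘_; id; _on_)
open import Relation.Binary.PropositionalEquality using (_≡_; _≢_; sym; trans; ≢-sym)
open import Relation.Binary.Construct.Closure.ReflexiveTransitive using (gmap) renaming (reverse to reverse-path)

two-colouring : {a b c : Bool} → a ≢ b → b ≢ c → a ≡ c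
two-colouring a≢b b≢c = trans (¬-not a≢b) (sym (¬-not (≢-sym b≢c)))

module Skew (H : Bigraph) where
  open Bigraph H
  open PairDigraph H using (Arc; arc-same; arc-diff; Reach; _⇄_)

  arc-swap : ∀ {x y} → Arc x y → Arc (swap y) (swap x)
  arc-swap (arc-same u≢v u'≢v cu≡cv uu' ¬vu') =
    arc-diff (≢-sym u'≢v) (≢-sym u≢v)
      (λ cv≡cu' → E-bip uu' (trans cu≡cv cv≡cu')) (E-sym uu') ¬vu'
  arc-swap (arc-diff u≢v u≢v' cu≢cv vv' ¬uv) =
    arc-same (≢-sym u≢v') (≢-sym u≢v)
      (sym (two-colouring cu≢cv (E-bip vv'))) (E-sym vv') ¬uv

  reach-swap : ∀ {x y} → Reach x y → Reach (swap y) (swap x)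
  reach-swap = gmap swap id ∘ reverse-path {U = Arc on swap} arc-swap

  ⇄-swap : ∀ {x y} → x ⇄ y → swap x ⇄ swap y
  ⇄-swap (x⇝y , y⇝x) = reach-swap y⇝x , reach-swap x⇝y

lemma2p2 : (H : Bigraph) (S : PairDigraph.V H × PairDigraph.V H → Set) →
    PairDigraph.StrongComponent H S →
    PairDigraph.StrongComponent H (PairDigraph.reverse H S)
lemma2p2 H S component = record
  { vertices  = λ { (u , v) Svu u≡v → vertices (v , u) Svu (sym u≡v) }
  ; nonempty  = let ((u , v) , Suv) = nonempty in (v , u) , Suv
  ; connected = λ { (u , v) (u' , v') Svu Sv'u' →
                    ⇄-swap (connected (v , u) (v' , u') Svu Sv'u') }
  ; maximal   = λ { (u , v) (u' , v') Svu u'≢v' uv⇄u'v' →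
                    maximal (v , u) (v' , u') Svu (≢-sym u'≢v') (⇄-swap uv⇄u'v') }
  }
  where
  open PairDigraph.StrongComponent component
  open Skew H
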